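{- In the setting described in the context, let $u\in A\setminus C$ with $w(u)=2$. Let $D_1$ (resp. $D_2$) be the set of $v\in B_d$ connected to $u$ by exactly one edge (resp. exactly two parallel edges). Then $|N(u,B_1\cup B_2)|+2|N(u,B_c)|+|D_1|+2|D_2|\le 2$.
   Context: Setting: $\mathcal{S}$ is an instance of the hereditary $3$-set packing problem, i.e., a finite family of nonempty sets of cardinality at most $3$ such that every nonempty subset of a member is a member; $w(s)=|s|-1$, $w(X)=\sum_{s\in X}w(s)$. A feasible solution is a subfamily of pairwise disjoint sets. $N(U,W)=\{x\in W:\exists u\in U:u\cap x\ne\emptyset\}$ and $N(u,W)=N(\{u\},W)$. A family $X\subseteq\mathcal{S}$ of pairwise disjoint sets is a local improvement of a feasible solution $A$ of size $|X|$ if $w(X)>w(N(X,A))$, or $w(X)=w(N(X,A))$ and $X$ contains more sets of weight $2$ than $N(X,A)$. $A$ is a feasible solution with no local improvement of size at most $10$ and $B$ is an optimum feasible solution; $A$ and $B$ consist of sets of cardinality $2$ or $3$. The conflict graph $G$ is the bipartite multigraph on $A\dot\cup B$ with exactly $|a\cap b|$ parallel edges between $a\in A$ and $b\in B$; neighbors and incident edges refer to $G$. $B_1$ is the set of $v\in B$ with exactly one neighbor in $A$; $B_2$ is the set of $v\in B$ with $w(v)=2$ having exactly two incident edges whose endpoints in $A$ are distinct. Step 1: each $v\in B_1$ sends $w(v)$ to its unique neighbor in $A$, and each $v\in B_2$ sends $1$ along each of its two edges. $C$ is the set of $u\in A$ whose total amount received in Step 1 equals exactly $w(u)$. (In this setting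 every $v\in B\setminus(B_1\cup B_2)$ with $w(v)=2$ has exactly three incident edges, at least one of which goes to $A\setminus C$.) $B_c$ is the set of $v\in B\setminus(B_1\cup B_2)$ with $w(v)=2$ having exactly one incident edge to $A\setminus C$; $B_d$ is the set of such $v$ having exactly two incident edges to $A\setminus C$. -}

module Defs where

open import Data.Bool using (Bool; true; false; not; _∧_; _∨_)
open import Data.Nat using (ℕ; _+_; _∸_; _≤_; _<_; _≡ᵇ_; _≤ᵇ_)
open import Data.Fin using (Fin)
open import Data.Fin.Subset using (Subset; _∩_; ∣_∣; _⊆_; Nonempty; Empty)
open import Data.List using (List; []; _∷_; length; map; filterᵇ)
open import Data.Nat.ListAction using (sum)
open import Data.Bool.ListAction using (any)
open import Data.List.Membership.Propositional using (_∈_)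
open import Data.List.Relation.Unary.All using (All)
open import Data.List.Relation.Unary.AllPairs using (AllPairs)
open import Data.List.Relation.Unary.Unique.Propositional using (Unique)
open import Data.Product using (_×_)
open import Data.Sum using (_⊎_)
open import Relation.Binary.PropositionalEquality using (_≡_)
open import Relation.Nullary using (¬_)

-- Ground set: Fin n.  Sets: subsets of Fin n.  Families: duplicate-free lists of subsets.
Family : ℕ → Set
Family n = List (Subset n)

module _ {n : ℕ} where

  w : Subset n → ℕ
  w s = ∣ s ∣ ∸ 1

  wF : Family n → ℕ
  wF X = sum (map w X)

  count2 : Family n → ℕ
  count2 X = length (filterᵇ (λ s → w s ≡ᵇ 2) X)

  Disjoint : Subset n → Subset n → Set
  Disjoint s t = Empty (s ∩ t)

  record Instance (𝒮 : Family n) : Set where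
    field
      unique     : Unique 𝒮
      nonempty   : All Nonempty 𝒮
      size≤3     : All (λ s → ∣ s ∣ ≤ 3) 𝒮
      hereditary : ∀ {s t} → s ∈ 𝒮 → t ⊆ s → Nonempty t → t ∈ 𝒮

  Packing : Family n → Family n → Set
  Packing 𝒮 X = All (_∈ 𝒮) X × AllPairs Disjoint X

  Feasible : Family n → Family n → Set
  Feasible 𝒮 X = Packing 𝒮 X × Unique X

  -- number of edges between a and b in the conflict graph
  edges : Subset n → Subset n → ℕ
  edges a b = ∣ a ∩ b ∣

  meets : Subset n → Subset n → Bool
  meets u x = 1 ≤ᵇ edges u x

  N : Family n → Family n → Family n
  N U W = filterᵇ (λ x → any (λ u → meets u x) U) W

  LocalImprovement : Family n → Family n → Set
  LocalImprovement A X =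
    wF (N X A) < wF X ⊎ (wF X ≡ wF (N X A) × count2 (N X A) < count2 X)

  NoLocalImprovement≤ : ℕ → Family n → Family n → Set
  NoLocalImprovement≤ k 𝒮 A =
    ∀ X → Packing 𝒮 X → length X ≤ k → ¬ LocalImprovement A X

  Optimum : Family n → Family n → Set
  Optimum 𝒮 B = Feasible 𝒮 B × (∀ X → Feasible 𝒮 X → wF X ≤ wF B)

  deg : Family n → Subset n → ℕ
  deg W v = sum (map (λ a → edges a v) W)

  module Classes (A B : Family n) where

    isB1 : Subset n → Bool
    isB1 v = length (N (v ∷ []) A) ≡ᵇ 1

    isB2 : Subset n → Bool
    isB2 v = (w v ≡ᵇ 2) ∧ (deg A v ≡ᵇ 2) ∧ (length (N (v ∷ []) A) ≡ᵇ 2)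

    B₁ : Family n
    B₁ = filterᵇ isB1 B

    B₂ : Family n
    B₂ = filterᵇ isB2 B

    -- amount received by u in Step 1
    received : Subset n → ℕ
    received u = wF (filterᵇ (meets u) B₁) + sum (map (edges u) B₂)

    isC : Subset n → Bool
    isC u = received u ≡ᵇ w u

    C : Family n
    C = filterᵇ isC A

    AminusC : Family n
    AminusC = filterᵇ (λ a → not (isC a)) A

    rest2 : Family n
    rest2 = filterᵇ (λ v → not (isB1 v ∨ isB2 v) ∧ (w v ≡ᵇ 2)) B

    Bc : Family n
    Bc = filterᵇ (λ v → deg AminusC v ≡ᵇ 1) rest2

    Bd : Family n
    Bd = filterᵇ (λ v → deg AminusC v ≡ᵇ 2) rest2

    B₁∪B₂ : Family n
    B₁∪B₂ = filterᵇ (λ v → isB1 v ∨ isB2 v) B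

    D₁ : Subset n → Family n
    D₁ u = filterᵇ (λ v → edges u v ≡ᵇ 1) Bd

    D₂ : Subset n → Family n
    D₂ u = filterᵇ (λ v → edges u v ≡ᵇ 2) Bd

-- Every v ∈ B contributes a weight ℓ(v) ≤ 2 to the left-hand side, which is therefore ∑_{v ∈ B} ℓ(v).
-- If this sum were at least 3, one could mark sets S ⊆ B of positive weight with ℓ(S) ≥ 3 and
-- |S| + 2 ℓ(S) ≤ 10. Let Cₘ be the sets of C meeting a marked set, and let X consist of the marked sets
-- and of the sets paying something to Cₘ in Step 1, each stripped of its elements lying in sets of A
-- other than u and those of Cₘ. Then X conflicts only with u and Cₘ, so w(N(X, A)) ≤ 2 + w(Cₘ). As every
-- a ∈ C receives exactly w(a), a case analysis on the class of each set of X gives w(X) ≥ ℓ(S) + w(Cₘ),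
-- and a marked set v has at most ℓ(v) edges to C, so |X| ≤ |S| + w(Cₘ) ≤ |S| + 2|Cₘ| ≤ |S| + 2 ℓ(S) ≤ 10:
-- X would be a local improvement.

module Submission where

open import Defs

open import Data.Bool using (Bool; true; false; not; _∧_; _∨_; T; if_then_else_)
import Data.Bool as Bool
open import Data.Bool.ListAction using (any)
open import Data.Bool.Properties using (∨-identityʳ; T-∧; T-≡)
open import Data.Empty using (⊥-elim)
open import Data.Fin using (zero)
open import Data.Fin.Subset using (Subset; inside; outside; _∩_; _∪_; ∁; ⋃; ⊤; ∣_∣; _⊆_; Nonempty; Empty)
  renaming (_∈_ to _∈ˢ_; _∉_ to _∉ˢ_)
open import Data.Fin.Subset.Properties
  using ( drop-∷-Empty; Empty-unique; ∣⊥∣≡0; nonempty?; ∉⊥; p∩q⊆p; p∩q⊆q; x∈p∩q⁺; x∈p∩q⁻; x∈p∪q⁻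
        ; p⊆p∪q; q⊆p∪q; x∈∁p⇒x∉p; p∪∁p≡⊤; ∣p∩q∣≤∣p∣; ∩-comm; ∩-zeroʳ; ∩-identityʳ; ∩-distribˡ-∪ )
open import Data.List using (List; []; _∷_; length; map; filterᵇ)
open import Data.List.Properties using (length-map)
open import Data.List.Membership.Propositional using (_∈_; find; lose)
open import Data.List.Membership.Propositional.Properties using (∈-map⁺; ∈-map⁻; ∈-filter⁺; ∈-filter⁻)
open import Data.List.Relation.Binary.Subset.Propositional.Properties using (map⁺; filter-⊆)
open import Data.List.Relation.Unary.All using (All; []; _∷_; lookup; tabulate)
import Data.List.Relation.Unary.All.Properties as Allₚ
open import Data.List.Relation.Unary.AllPairs using (AllPairs; []; _∷_)
import Data.List.Relation.Unary.AllPairs as AllPairs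
import Data.List.Relation.Unary.AllPairs.Properties as AllPairsₚ
open import Data.List.Relation.Unary.Any using (here; there)
open import Data.List.Relation.Unary.Any.Properties using (any⁺; any⁻)
open import Data.List.Relation.Unary.Unique.Propositional using (Unique)
open import Data.Nat using (ℕ; zero; suc; _+_; _*_; _∸_; _≤_; _<_; _≡ᵇ_; _≤ᵇ_; z≤n; s≤s; _≤?_)
open import Data.Nat.ListAction using (sum)
open import Data.Nat.Properties
open import Algebra.Properties.CommutativeSemigroup +-commutativeSemigroup using (interchange; xy∙z≈xz∙y)
open import Data.Product using (Σ-syntax; _×_; _,_; proj₁; proj₂)
open import Data.Sum using (_⊎_; inj₁; inj₂)
open import Data.Vec using ([]; _∷_; here)
open import Data.Vec.Properties using (≡-dec)
open import Function using (id; _∘_; _∘′_; Equivalence)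
open import Relation.Binary.Definitions using (DecidableEquality)
open import Relation.Binary.PropositionalEquality
  using (_≡_; _≢_; refl; sym; trans; cong; cong₂; subst; subst₂; module ≡-Reasoning)
open import Relation.Nullary using (¬_; does; yes; no; contradiction)
open import Relation.Nullary.Decidable using (T?)

-- Sums over lists

private variable I J : Set

∑ : List I → (I → ℕ) → ℕ
∑ xs f = sum (map f xs)

syntax ∑ xs (λ x → e) = ∑[ x ∈ xs ] e

∑-cong : ∀ (xs : List I) {f g : I → ℕ} → (∀ {x} → x ∈ xs → f x ≡ g x) → ∑ xs f ≡ ∑ xs g
∑-cong []       eq = refl
∑-cong (x ∷ xs) eq = cong₂ _+_ (eq (here refl)) (∑-cong xs (eq ∘ there))

∑-mono-≤ : ∀ (xs : List I) {f g : I → ℕ} → (∀ {x} → x ∈ xs → f x ≤ g x) → ∑ xs f ≤ ∑ xs g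
∑-mono-≤ []       le = z≤n
∑-mono-≤ (x ∷ xs) le = +-mono-≤ (le (here refl)) (∑-mono-≤ xs (le ∘ there))

∑-+ : ∀ (xs : List I) (f g : I → ℕ) → ∑[ x ∈ xs ] (f x + g x) ≡ ∑ xs f + ∑ xs g
∑-+ []       f g = refl
∑-+ (x ∷ xs) f g = trans (cong (f x + g x +_) (∑-+ xs f g)) (interchange (f x) (g x) _ _)

∑-*ˡ : ∀ (xs : List I) k (f : I → ℕ) → ∑[ x ∈ xs ] (k * f x) ≡ k * ∑ xs f
∑-*ˡ []       k f = sym (*-zeroʳ k)
∑-*ˡ (x ∷ xs) k f = trans (cong (k * f x +_) (∑-*ˡ xs k f)) (sym (*-distribˡ-+ k (f x) _))

∑-+-* : ∀ (xs : List I) (f g : I → ℕ) k → ∑ xs f + k * ∑ xs g ≡ ∑[ x ∈ xs ] (f x + k * g x)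
∑-+-* xs f g k = trans (cong (∑ xs f +_) (sym (∑-*ˡ xs k g))) (sym (∑-+ xs f (λ x → k * g x)))

∑-map : ∀ (g : I → J) (xs : List I) (f : J → ℕ) → ∑ (map g xs) f ≡ ∑ xs (f ∘ g)
∑-map g []       f = refl
∑-map g (x ∷ xs) f = cong (f (g x) +_) (∑-map g xs f)

∑-zeros : ∀ (xs : List I) → ∑[ x ∈ xs ] 0 ≡ 0
∑-zeros []       = refl
∑-zeros (x ∷ xs) = ∑-zeros xs

∑-comm : ∀ (xs : List I) (ys : List J) (f : I → J → ℕ) →
         ∑[ x ∈ xs ] ∑[ y ∈ ys ] f x y ≡ ∑[ y ∈ ys ] ∑[ x ∈ xs ] f x y
∑-comm []       ys f = sym (∑-zeros ys)
∑-comm (x ∷ xs) ys f = trans (cong (∑ ys (f x) +_) (∑-comm xs ys f)) (sym (∑-+ ys (f x) _))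

∑-if : ∀ (xs : List I) c (f : I → ℕ) → ∑[ x ∈ xs ] (if c then f x else 0) ≡ (if c then ∑ xs f else 0)
∑-if xs true  f = refl
∑-if xs false f = ∑-zeros xs

∑-member : ∀ {xs : List I} {x} (f : I → ℕ) → x ∈ xs → f x ≤ ∑ xs f
∑-member {xs = y ∷ xs} f (here refl) = m≤m+n (f y) _
∑-member {xs = y ∷ xs} f (there x∈) = ≤-trans (∑-member f x∈) (m≤n+m _ (f y))

length≡∑1 : ∀ (xs : List I) → length xs ≡ ∑[ x ∈ xs ] 1
length≡∑1 []       = refl
length≡∑1 (x ∷ xs) = cong suc (length≡∑1 xs)

∑-filterᵇ : ∀ (p : I → Bool) (xs : List I) (f : I → ℕ) →
            ∑ (filterᵇ p xs) f ≡ ∑[ x ∈ xs ] (if p x then f x else 0)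
∑-filterᵇ p []       f = refl
∑-filterᵇ p (x ∷ xs) f with p x
... | true  = cong (f x +_) (∑-filterᵇ p xs f)
... | false = ∑-filterᵇ p xs f

length-filterᵇ : ∀ (p : I → Bool) (xs : List I) → length (filterᵇ p xs) ≡ ∑[ x ∈ xs ] (if p x then 1 else 0)
length-filterᵇ p xs = trans (length≡∑1 (filterᵇ p xs)) (∑-filterᵇ p xs (λ _ → 1))

∑-filterᵇ-split : ∀ (p : I → Bool) (xs : List I) (f : I → ℕ) →
                  ∑ xs f ≡ ∑ (filterᵇ p xs) f + ∑ (filterᵇ (not ∘ p) xs) f
∑-filterᵇ-split p xs f = sym (begin
  ∑ (filterᵇ p xs) f + ∑ (filterᵇ (not ∘ p) xs) f
    ≡⟨ cong₂ _+_ (∑-filterᵇ p xs f) (∑-filterᵇ (not ∘ p) xs f) ⟩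
  ∑[ x ∈ xs ] (if p x then f x else 0) + ∑[ x ∈ xs ] (if not (p x) then f x else 0)
    ≡⟨ ∑-+ xs (λ x → if p x then f x else 0) (λ x → if not (p x) then f x else 0) ⟨
  ∑[ x ∈ xs ] ((if p x then f x else 0) + (if not (p x) then f x else 0))
    ≡⟨ ∑-cong xs (λ {x} _ → if+if-not (p x) (f x)) ⟩
  ∑ xs f ∎)
  where
  open ≡-Reasoning
  if+if-not : ∀ b m → (if b then m else 0) + (if not b then m else 0) ≡ m
  if+if-not true  m = +-identityʳ m
  if+if-not false m = refl

∑-filterᵇ-∨ : ∀ (p q : I → Bool) (xs : List I) (f : I → ℕ) →
              (∀ {x} → x ∈ xs → T (p x) → q x ≡ false) →
              ∑ (filterᵇ (λ x → p x ∨ q x) xs) f ≡ ∑ (filterᵇ p xs) f + ∑ (filterᵇ q xs) f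
∑-filterᵇ-∨ p q xs f exclusive = begin
  ∑ (filterᵇ (λ x → p x ∨ q x) xs) f
    ≡⟨ ∑-filterᵇ (λ x → p x ∨ q x) xs f ⟩
  ∑[ x ∈ xs ] (if p x ∨ q x then f x else 0)
    ≡⟨ ∑-cong xs (λ {x} x∈ → if-∨ (p x) (q x) (f x) (exclusive x∈)) ⟩
  ∑[ x ∈ xs ] ((if p x then f x else 0) + (if q x then f x else 0))
    ≡⟨ ∑-+ xs (λ x → if p x then f x else 0) (λ x → if q x then f x else 0) ⟩
  ∑[ x ∈ xs ] (if p x then f x else 0) + ∑[ x ∈ xs ] (if q x then f x else 0)
    ≡⟨ cong₂ _+_ (∑-filterᵇ p xs f) (∑-filterᵇ q xs f) ⟨
  ∑ (filterᵇ p xs) f + ∑ (filterᵇ q xs) f ∎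
  where
  open ≡-Reasoning
  if-∨ : ∀ a b m → (T a → b ≡ false) → (if a ∨ b then m else 0) ≡ (if a then m else 0) + (if b then m else 0)
  if-∨ true  b m excl rewrite excl _ = sym (+-identityʳ m)
  if-∨ false b m excl = refl

∑-filterᵇ-mono-≤ : ∀ (p q : I → Bool) (xs : List I) (f : I → ℕ) →
                   (∀ {x} → x ∈ xs → T (p x) → 1 ≤ f x → T (q x)) →
                   ∑ (filterᵇ p xs) f ≤ ∑ (filterᵇ q xs) f
∑-filterᵇ-mono-≤ p q xs f p⇒q = begin
  ∑ (filterᵇ p xs) f                          ≡⟨ ∑-filterᵇ p xs f ⟩
  ∑[ x ∈ xs ] (if p x then f x else 0)        ≤⟨ ∑-mono-≤ xs (λ {x} x∈ → if-mono (p x) (q x) (f x) (p⇒q x∈)) ⟩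
  ∑[ x ∈ xs ] (if q x then f x else 0)        ≡⟨ ∑-filterᵇ q xs f ⟨
  ∑ (filterᵇ q xs) f                          ∎
  where
  open ≤-Reasoning
  if-mono : ∀ a b m → (T a → 1 ≤ m → T b) → (if a then m else 0) ≤ (if b then m else 0)
  if-mono false b     m imp = z≤n
  if-mono true  true  m imp = ≤-refl
  if-mono true  false zero    imp = z≤n
  if-mono true  false (suc m) imp = contradiction (imp _ (s≤s z≤n)) λ ()

∑≡0-transfer : ∀ (xs : List I) {f g : I → ℕ} → (∀ {x} → x ∈ xs → f x ≡ 0 → g x ≡ 0) →
               ∑ xs f ≡ 0 → ∑ xs g ≡ 0
∑≡0-transfer []       imp eq = refl
∑≡0-transfer (x ∷ xs) imp eq =
  cong₂ _+_ (imp (here refl) (m+n≡0⇒m≡0 _ eq)) (∑≡0-transfer xs (imp ∘ there) (m+n≡0⇒n≡0 _ eq))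

module _ (_≟_ : DecidableEquality I) where

  ∑-filterᵇ-≟ : ∀ {xs : List I} {x} (f : I → ℕ) → Unique xs → x ∈ xs →
                ∑ (filterᵇ (λ y → does (y ≟ x)) xs) f ≡ f x
  ∑-filterᵇ-≟ {x ∷ xs} {x} f (x≢xs ∷ _) (here refl) with x ≟ x
  ... | no x≢x = contradiction refl x≢x
  ... | yes _  = trans (cong (f x +_) nothing-else) (+-identityʳ (f x))
    where
    nothing-else : ∑ (filterᵇ (λ y → does (y ≟ x)) xs) f ≡ 0
    nothing-else = begin
      ∑ (filterᵇ (λ y → does (y ≟ x)) xs) f         ≡⟨ ∑-filterᵇ (λ y → does (y ≟ x)) xs f ⟩
      ∑[ y ∈ xs ] (if does (y ≟ x) then f y else 0) ≡⟨ ∑-cong xs (λ y∈ → not-x (lookup x≢xs y∈)) ⟩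
      ∑[ y ∈ xs ] 0                                 ≡⟨ ∑-zeros xs ⟩
      0                                             ∎
      where
      open ≡-Reasoning
      not-x : ∀ {y} → x ≢ y → (if does (y ≟ x) then f y else 0) ≡ 0
      not-x {y} x≢y with y ≟ x
      ... | yes refl = contradiction refl x≢y
      ... | no _     = refl
  ∑-filterᵇ-≟ {y ∷ xs} {x} f (y≢xs ∷ unique) (there x∈) with y ≟ x
  ... | yes refl = contradiction refl (lookup y≢xs x∈)
  ... | no _     = ∑-filterᵇ-≟ f unique x∈

-- Cardinalities of finite sets

∣p∪q∣≡∣p∣+∣q∣ : ∀ {n} (p q : Subset n) → Disjoint p q → ∣ p ∪ q ∣ ≡ ∣ p ∣ + ∣ q ∣
∣p∪q∣≡∣p∣+∣q∣ []            []            _   = refl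
∣p∪q∣≡∣p∣+∣q∣ (inside  ∷ p) (inside  ∷ q) p#q = contradiction (zero , here) p#q
∣p∪q∣≡∣p∣+∣q∣ (inside  ∷ p) (outside ∷ q) p#q = cong suc (∣p∪q∣≡∣p∣+∣q∣ p q (drop-∷-Empty p#q))
∣p∪q∣≡∣p∣+∣q∣ (outside ∷ p) (inside  ∷ q) p#q =
  trans (cong suc (∣p∪q∣≡∣p∣+∣q∣ p q (drop-∷-Empty p#q))) (sym (+-suc ∣ p ∣ ∣ q ∣))
∣p∪q∣≡∣p∣+∣q∣ (outside ∷ p) (outside ∷ q) p#q = ∣p∪q∣≡∣p∣+∣q∣ p q (drop-∷-Empty p#q)

module _ {n : ℕ} where

  disjoint : {p q : Subset n} → (∀ {x} → x ∈ˢ p → x ∉ˢ q) → Disjoint p q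
  disjoint p∩q=∅ (x , x∈p∩q) = let x∈p , x∈q = x∈p∩q⁻ _ _ x∈p∩q in p∩q=∅ x∈p x∈q

  Empty⇒∣p∣≡0 : {p : Subset n} → Empty p → ∣ p ∣ ≡ 0
  Empty⇒∣p∣≡0 p=∅ = trans (cong ∣_∣ (Empty-unique p=∅)) (∣⊥∣≡0 n)

  ∣p∣>0⇒Nonempty : (p : Subset n) → 1 ≤ ∣ p ∣ → Nonempty p
  ∣p∣>0⇒Nonempty p ∣p∣>0 with nonempty? p
  ... | yes p≠∅ = p≠∅
  ... | no  p=∅ = contradiction (Empty⇒∣p∣≡0 p=∅) (>⇒≢ ∣p∣>0)

  ∣p∩q∣+∣p∩∁q∣≡∣p∣ : (p q : Subset n) → ∣ p ∩ q ∣ + ∣ p ∩ ∁ q ∣ ≡ ∣ p ∣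
  ∣p∩q∣+∣p∩∁q∣≡∣p∣ p q = begin
    ∣ p ∩ q ∣ + ∣ p ∩ ∁ q ∣   ≡⟨ ∣p∪q∣≡∣p∣+∣q∣ (p ∩ q) (p ∩ ∁ q) (disjoint λ x∈ x∈′ →
                                  x∈∁p⇒x∉p (p∩q⊆q p (∁ q) x∈′) (p∩q⊆q p q x∈)) ⟨
    ∣ (p ∩ q) ∪ (p ∩ ∁ q) ∣  ≡⟨ cong ∣_∣ (∩-distribˡ-∪ p q (∁ q)) ⟨
    ∣ p ∩ (q ∪ ∁ q) ∣        ≡⟨ cong (λ r → ∣ p ∩ r ∣) (p∪∁p≡⊤ q) ⟩
    ∣ p ∩ ⊤ ∣                ≡⟨ cong ∣_∣ (∩-identityʳ p) ⟩
    ∣ p ∣                    ∎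
    where open ≡-Reasoning

  ⊆⋃ : {a : Subset n} {as : List (Subset n)} → a ∈ as → a ⊆ ⋃ as
  ⊆⋃ {as = a ∷ as} (here refl) = p⊆p∪q (⋃ as)
  ⊆⋃ {as = b ∷ as} (there a∈)  = q⊆p∪q b (⋃ as) ∘′ ⊆⋃ a∈

  Disjoint-⋃ : {a : Subset n} {as : List (Subset n)} → All (Disjoint a) as → Disjoint a (⋃ as)
  Disjoint-⋃ {as = []}     []          (x , x∈a∩∅) = ∉⊥ (p∩q⊆q _ _ x∈a∩∅)
  Disjoint-⋃ {as = b ∷ as} (a#b ∷ a#as) (x , x∈a∩⋃) with x∈p∩q⁻ _ _ x∈a∩⋃
  ... | x∈a , x∈b∪⋃ with x∈p∪q⁻ b (⋃ as) x∈b∪⋃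
  ...   | inj₁ x∈b = a#b (x , x∈p∩q⁺ (x∈a , x∈b))
  ...   | inj₂ x∈⋃ = Disjoint-⋃ a#as (x , x∈p∩q⁺ (x∈a , x∈⋃))

  ∣b∩⋃∣≡deg : (b : Subset n) {as : List (Subset n)} → AllPairs Disjoint as → ∣ b ∩ ⋃ as ∣ ≡ deg as b
  ∣b∩⋃∣≡deg b {[]}     []              = trans (cong ∣_∣ (∩-zeroʳ b)) (∣⊥∣≡0 n)
  ∣b∩⋃∣≡deg b {a ∷ as} (a#as ∷ disjoint-as) = begin
    ∣ b ∩ (a ∪ ⋃ as) ∣           ≡⟨ cong ∣_∣ (∩-distribˡ-∪ b a (⋃ as)) ⟩
    ∣ (b ∩ a) ∪ (b ∩ ⋃ as) ∣     ≡⟨ ∣p∪q∣≡∣p∣+∣q∣ (b ∩ a) (b ∩ ⋃ as) (disjoint λ x∈ x∈′ →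
                                    Disjoint-⋃ a#as (_ , x∈p∩q⁺ (p∩q⊆q b a x∈ , p∩q⊆q b (⋃ as) x∈′))) ⟩
    ∣ b ∩ a ∣ + ∣ b ∩ ⋃ as ∣     ≡⟨ cong₂ _+_ (cong ∣_∣ (∩-comm b a)) (∣b∩⋃∣≡deg b disjoint-as) ⟩
    edges a b + deg as b         ∎
    where open ≡-Reasoning

  deg≤∣∣ : (b : Subset n) {as : List (Subset n)} → AllPairs Disjoint as → deg as b ≤ ∣ b ∣
  deg≤∣∣ b {as} disjoint-as = subst (_≤ ∣ b ∣) (∣b∩⋃∣≡deg b disjoint-as) (∣p∩q∣≤∣p∣ b (⋃ as))

  ∩-Disjoint : {p q : Subset n} (r : Subset n) → Disjoint p q → Disjoint (p ∩ r) (q ∩ r)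
  ∩-Disjoint r p#q = disjoint λ x∈ x∈′ → p#q (_ , x∈p∩q⁺ (p∩q⊆p _ r x∈ , p∩q⊆p _ r x∈′))

-- Neighbourhoods in the conflict graph

module _ {n : ℕ} where

  nbrs : Family n → Subset n → ℕ
  nbrs W b = length (N (b ∷ []) W)

  adjacent : Subset n → Subset n → ℕ
  adjacent a b = if meets a b then 1 else 0

  meets-comm : (a b : Subset n) → meets a b ≡ meets b a
  meets-comm a b = cong (λ s → 1 ≤ᵇ ∣ s ∣) (∩-comm a b)

  nbrs≡∑adjacent : (W : Family n) (b : Subset n) → nbrs W b ≡ ∑[ a ∈ W ] adjacent a b
  nbrs≡∑adjacent W b = trans (length-filterᵇ (λ a → meets b a ∨ false) W)
    (∑-cong W λ {a} _ → cong (λ m → if m then 1 else 0) (trans (∨-identityʳ (meets b a)) (meets-comm b a)))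

  nbrs≡0⇒deg≡0 : (W : Family n) (b : Subset n) → nbrs W b ≡ 0 → deg W b ≡ 0
  nbrs≡0⇒deg≡0 W b nbrs≡0 =
    ∑≡0-transfer W (λ {a} _ → not-adjacent (edges a b)) (trans (sym (nbrs≡∑adjacent W b)) nbrs≡0)
    where
    not-adjacent : ∀ e → (if 1 ≤ᵇ e then 1 else 0) ≡ 0 → e ≡ 0
    not-adjacent zero    _  = refl
    not-adjacent (suc _) ()

  adjacent≡1 : (a b : Subset n) → 1 ≤ edges a b → adjacent a b ≡ 1
  adjacent≡1 a b = positive (edges a b)
    where
    positive : ∀ e → 1 ≤ e → (if 1 ≤ᵇ e then 1 else 0) ≡ 1
    positive (suc _) _ = refl

-- Marking a list

marked : List (I × Bool) → List I
marked M = map proj₁ (filterᵇ proj₂ M)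

record Marking (xs : List I) (P : List I → Set) : Set where
  constructor mkMarking
  field
    marking : List (I × Bool)
    covers  : map proj₁ marking ≡ xs
    holds   : P (marked marking)

module _ {x : I} {xs : List I} {P Q : List I → Set} where

  skip : (∀ {S} → P S → Q S) → Marking xs P → Marking (x ∷ xs) Q
  skip P⇒Q (mkMarking M refl PM) = mkMarking ((x , false) ∷ M) refl (P⇒Q PM)

  keep : (∀ {S} → P S → Q (x ∷ S)) → Marking xs P → Marking (x ∷ xs) Q
  keep P⇒Q (mkMarking M refl PM) = mkMarking ((x , true) ∷ M) refl (P⇒Q PM)

module _ (ℓ : I → ℕ) where

  Positive : List I → Set
  Positive = All (λ x → 1 ≤ ℓ x)

  length≤∑ : ∀ {S} → Positive S → length S ≤ ∑ S ℓ
  length≤∑ []            = z≤n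
  length≤∑ (1≤ℓx ∷ pos)  = +-mono-≤ 1≤ℓx (length≤∑ pos)

  mark-positives : ∀ xs → Marking xs (λ S → Positive S × ∑ S ℓ ≡ ∑ xs ℓ)
  mark-positives []       = mkMarking [] refl ([] , refl)
  mark-positives (x ∷ xs) with ℓ x in ℓx≡
  ... | zero  = skip id (mark-positives xs)
  ... | suc k =
    keep (λ (pos , eq) → subst (1 ≤_) (sym ℓx≡) (s≤s z≤n) ∷ pos , cong₂ _+_ ℓx≡ eq) (mark-positives xs)

  mark-one : ∀ xs → 1 ≤ ∑ xs ℓ → Marking xs (λ S → Σ[ y ∈ I ] S ≡ y ∷ [] × 1 ≤ ℓ y)
  mark-one (x ∷ xs) 1≤∑ with ℓ x in ℓx≡
  ... | zero  = skip id (mark-one xs 1≤∑)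
  ... | suc k = keep (λ {S} S≡[] → x , cong (x ∷_) S≡[] , subst (1 ≤_) (sym ℓx≡) (s≤s z≤n)) (mark-none xs)
    where
    mark-none : ∀ xs → Marking xs (_≡ [])
    mark-none []       = mkMarking [] refl refl
    mark-none (x ∷ xs) = skip id (mark-none xs)

  Good : List I → Set
  Good S = Positive S × 3 ≤ ∑ S ℓ × length S + 2 * ∑ S ℓ ≤ 10

  select : (∀ x → ℓ x ≤ 2) → ∀ xs → 3 ≤ ∑ xs ℓ → Marking xs Good
  select ℓ≤2 (x ∷ xs) 3≤∑ with 3 ≤? ∑ xs ℓ
  ... | yes 3≤∑xs = skip id (select ℓ≤2 xs 3≤∑xs)
  ... | no  3≰∑xs with ℓ x in ℓx≡
  ...   | 0 = contradiction 3≤∑ 3≰∑xs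
  ...   | 1 = keep with-all-positives (mark-positives xs)
    where
    with-all-positives : ∀ {S} → Positive S × ∑ S ℓ ≡ ∑ xs ℓ → Good (x ∷ S)
    with-all-positives {S} (pos , ∑S≡) = pos′ , enough , cheap
      where
      pos′ : Positive (x ∷ S)
      pos′ = subst (1 ≤_) (sym ℓx≡) ≤-refl ∷ pos
      ∑≡ : ∑ (x ∷ S) ℓ ≡ 1 + ∑ xs ℓ
      ∑≡ = cong₂ _+_ ℓx≡ ∑S≡
      enough : 3 ≤ ∑ (x ∷ S) ℓ
      enough = subst (3 ≤_) (sym ∑≡) 3≤∑
      cheap : length (x ∷ S) + 2 * ∑ (x ∷ S) ℓ ≤ 10
      cheap = ≤-trans (+-mono-≤ (≤-trans (length≤∑ pos′) ∑≤3) (*-monoʳ-≤ 2 ∑≤3)) (n≤1+n 9)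
        where
        ∑≤3 : ∑ (x ∷ S) ℓ ≤ 3
        ∑≤3 = subst (_≤ 3) (sym ∑≡) (s≤s (≤-pred (≰⇒> 3≰∑xs)))
    -- Marking all remaining positive sets could overshoot: weights 2, 1, 1 give 3 + 2 · 4 = 11.
  ...   | 2 = keep with-one-more (mark-one xs (≤-pred (≤-pred 3≤∑)))
    where
    with-one-more : ∀ {S} → Σ[ y ∈ I ] S ≡ y ∷ [] × 1 ≤ ℓ y → Good (x ∷ S)
    with-one-more (y , refl , 1≤ℓy) = pos′ ∷ 1≤ℓy ∷ [] , enough , cheap
      where
      pos′ : 1 ≤ ℓ x
      pos′ = subst (1 ≤_) (sym ℓx≡) (s≤s z≤n)
      ∑≡ : ∑ (x ∷ y ∷ []) ℓ ≡ 2 + (ℓ y + 0)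
      ∑≡ = cong (_+ (ℓ y + 0)) ℓx≡
      enough : 3 ≤ ∑ (x ∷ y ∷ []) ℓ
      enough = subst (3 ≤_) (sym ∑≡) (s≤s (s≤s (+-monoˡ-≤ 0 1≤ℓy)))
      cheap : 2 + 2 * ∑ (x ∷ y ∷ []) ℓ ≤ 10
      cheap = subst (λ k → 2 + 2 * k ≤ 10) (sym ∑≡)
                (+-monoʳ-≤ 2 (*-monoʳ-≤ 2 (s≤s (s≤s (+-monoˡ-≤ 0 (ℓ≤2 y))))))
  ...   | suc (suc (suc _)) = contradiction (subst (_≤ 2) ℓx≡ (ℓ≤2 x)) λ where (s≤s (s≤s ()))

-- A single set of B

-- The contribution of v ∈ B to the left-hand side, computed from: v ∈ B₁ ∪ B₂, w(v) = 2,
-- the number of edges from v to A ∖ C, and the number of edges between u and v.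
lhs-weight : Bool → Bool → ℕ → ℕ → ℕ
lhs-weight true  _    _ (suc _) = 1
lhs-weight false true 1 (suc _) = 2
lhs-weight false true 2 1       = 1
lhs-weight false true 2 2       = 2
lhs-weight _     _    _ _       = 0

lhs-weight≤2 : ∀ x y d e → lhs-weight x y d e ≤ 2
lhs-weight≤2 true  y     d                   zero                = z≤n
lhs-weight≤2 true  y     d                   (suc e)             = s≤s z≤n
lhs-weight≤2 false false d                   e                   = z≤n
lhs-weight≤2 false true  0                   e                   = z≤n
lhs-weight≤2 false true  1                   zero                = z≤n
lhs-weight≤2 false true  1                   (suc e)             = ≤-refl
lhs-weight≤2 false true  2                   0                   = z≤n
lhs-weight≤2 false true  2                   1                   = s≤s z≤n
lhs-weight≤2 false true  2                   2                   = ≤-refl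
lhs-weight≤2 false true  2                   (suc (suc (suc e))) = z≤n
lhs-weight≤2 false true  (suc (suc (suc d))) e                   = z≤n

indicators≡lhs-weight : ∀ x y d e →
  (if x then (if (1 ≤ᵇ e) ∨ false then 1 else 0) else 0)
  + 2 * (if not x ∧ y then (if d ≡ᵇ 1 then (if (1 ≤ᵇ e) ∨ false then 1 else 0) else 0) else 0)
  + (if not x ∧ y then (if d ≡ᵇ 2 then (if e ≡ᵇ 1 then 1 else 0) else 0) else 0)
  + 2 * (if not x ∧ y then (if d ≡ᵇ 2 then (if e ≡ᵇ 2 then 1 else 0) else 0) else 0)
  ≡ lhs-weight x y d e
indicators≡lhs-weight true  y     d                   zero                = refl
indicators≡lhs-weight true  y     d                   (suc e)             = refl
indicators≡lhs-weight false false d                   e                   = refl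
indicators≡lhs-weight false true  0                   e                   = refl
indicators≡lhs-weight false true  1                   zero                = refl
indicators≡lhs-weight false true  1                   (suc e)             = refl
indicators≡lhs-weight false true  2                   0                   = refl
indicators≡lhs-weight false true  2                   1                   = refl
indicators≡lhs-weight false true  2                   2                   = refl
indicators≡lhs-weight false true  2                   (suc (suc (suc e))) = refl
indicators≡lhs-weight false true  (suc (suc (suc d))) e                   = refl

cost≤lhs-weight : ∀ β₁ β₂ y d e {D c} → D ≤ 3 → c + d ≡ D →
  (T β₁ → 1 ≤ e → c ≡ 0) → (T β₂ → 1 ≤ e → c ≤ 1) →
  1 ≤ lhs-weight (β₁ ∨ β₂) y d e → c ≤ lhs-weight (β₁ ∨ β₂) y d e
cost≤lhs-weight true  _     _    _ (suc _) _   _     B₁ _  _ = ≤-trans (≤-reflexive (B₁ _ (s≤s z≤n))) z≤n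
cost≤lhs-weight false true  _    _ (suc _) _   _     _  B₂ _ = B₂ _ (s≤s z≤n)
cost≤lhs-weight false false true 1 (suc _) D≤3 split _  _  _ = m+n≤o⇒m≤o∸n _ (≤-trans (≤-reflexive split) D≤3)
cost≤lhs-weight false false true 2 1       D≤3 split _  _  _ = m+n≤o⇒m≤o∸n _ (≤-trans (≤-reflexive split) D≤3)
cost≤lhs-weight false false true 2 2       D≤3 split _  _  _ =
  ≤-trans (m+n≤o⇒m≤o∸n _ (≤-trans (≤-reflexive split) D≤3)) (s≤s z≤n)

-- A set v ∈ B seen from a partition of A into u, Cₘ and a rest: s = |v|, t = |v| once the elements of
-- the rest are deleted, e, eT, eR the edges from v to u, Cₘ and the rest, kT, kR its neighbours in
-- Cₘ and in the rest.
record LocalView (β₁ β₂ y : Bool) (s t e eT eR kT kR : ℕ) : Set where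
  field
    size      : s ≡ 2 ⊎ s ≡ 3
    trimmed   : t + eR ≡ s
    B₁-nbrs   : T β₁ → (if 1 ≤ᵇ e then 1 else 0) + kT + kR ≡ 1
    rest-nbrs : kR ≡ 0 → eR ≡ 0
    B₂-degs   : T β₂ → β₁ ≡ false × s ≡ 3 × e + eT + eR ≡ 2
    w≡2       : T y → s ≡ 3

paid : Bool → Bool → ℕ → ℕ → ℕ → ℕ
paid β₁ β₂ s eT kT = (if β₁ then (s ∸ 1) * kT else 0) + (if β₂ then eT else 0)

fits : ∀ {x t r s} → t + r ≡ s → x + 1 + r ≤ s → x ≤ t ∸ 1
fits {x} {t} {r} t+r≡s le = m+n≤o⇒m≤o∸n x (+-cancelʳ-≤ r (x + 1) t (subst (x + 1 + r ≤_) (sym t+r≡s) le))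

n+1+o≤1+m+n+o : ∀ m n o → n + 1 + o ≤ suc (m + n + o)
n+1+o≤1+m+n+o m n o = begin
  n + 1 + o         ≡⟨ cong (_+ o) (+-comm n 1) ⟩
  suc (n + o)       ≤⟨ s≤s (m≤n+m (n + o) m) ⟩
  suc (m + (n + o)) ≡⟨ cong suc (+-assoc m n o) ⟨
  suc (m + n + o)   ∎
  where open ≤-Reasoning

paid≤trimmed-weight : ∀ {β₁ β₂ y s t e eT eR kT kR} → LocalView β₁ β₂ y s t e eT eR kT kR →
                      paid β₁ β₂ s eT kT ≤ t ∸ 1
paid≤trimmed-weight {true} {true} v = contradiction (proj₁ (LocalView.B₂-degs v _)) λ ()
paid≤trimmed-weight {true} {false} {s = s} {kT = zero} _ =
  ≤-trans (≤-reflexive (trans (+-identityʳ _) (*-zeroʳ (s ∸ 1)))) z≤n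
paid≤trimmed-weight {true} {false} {s = s} {e = zero} {kT = suc k} v = fits (LocalView.trimmed v)
  (subst₂ (λ k r → (s ∸ 1) * suc k + 0 + 1 + r ≤ s) (sym k≡0) (sym eR≡0) (whole (LocalView.size v)))
  where
  k+kR≡0 = suc-injective (LocalView.B₁-nbrs v _)
  k≡0    = m+n≡0⇒m≡0 k k+kR≡0
  eR≡0   = LocalView.rest-nbrs v (m+n≡0⇒n≡0 k k+kR≡0)
  whole : s ≡ 2 ⊎ s ≡ 3 → (s ∸ 1) * 1 + 0 + 1 + 0 ≤ s
  whole (inj₁ refl) = ≤-refl
  whole (inj₂ refl) = ≤-refl
paid≤trimmed-weight {true} {false} {e = suc _} {kT = suc _} v = contradiction (LocalView.B₁-nbrs v _) λ ()
paid≤trimmed-weight {false} {true} {e = e} {eT = eT} {eR = eR} v with LocalView.B₂-degs v _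
... | _ , refl , degs =
  fits (LocalView.trimmed v) (subst (λ k → eT + 1 + eR ≤ suc k) degs (n+1+o≤1+m+n+o e eT eR))
paid≤trimmed-weight {false} {false} _ = z≤n

weight+paid≤trimmed-weight : ∀ {β₁ β₂ y s t e eT eR kT kR} d → LocalView β₁ β₂ y s t e eT eR kT kR →
  e + eR ≤ d → 1 ≤ lhs-weight (β₁ ∨ β₂) y d e → lhs-weight (β₁ ∨ β₂) y d e + paid β₁ β₂ s eT kT ≤ t ∸ 1
weight+paid≤trimmed-weight {true} {true} _ v _ _ = contradiction (proj₁ (LocalView.B₂-degs v _)) λ ()
weight+paid≤trimmed-weight {true} {false} {s = s} {e = suc _} {kT = kT} _ v _ _ = fits (LocalView.trimmed v)
  (subst₂ (λ k r → 1 + ((s ∸ 1) * k + 0) + 1 + r ≤ s) (sym kT≡0) (sym eR≡0) (two≤ (LocalView.size v)))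
  where
  kT+kR≡0 = suc-injective (LocalView.B₁-nbrs v _)
  kT≡0    = m+n≡0⇒m≡0 kT kT+kR≡0
  eR≡0    = LocalView.rest-nbrs v (m+n≡0⇒n≡0 kT kT+kR≡0)
  two≤ : s ≡ 2 ⊎ s ≡ 3 → 1 + ((s ∸ 1) * 0 + 0) + 1 + 0 ≤ s
  two≤ (inj₁ refl) = ≤-refl
  two≤ (inj₂ refl) = s≤s (s≤s z≤n)
weight+paid≤trimmed-weight {false} {true} {e = suc e} {eT = eT} {eR = eR} _ v _ _ with LocalView.B₂-degs v _
... | _ , refl , degs = fits (LocalView.trimmed v)
  (s≤s (subst (λ k → eT + 1 + eR ≤ suc k) (suc-injective degs) (n+1+o≤1+m+n+o e eT eR)))
weight+paid≤trimmed-weight {false} {false} {true} {e = suc e} 1 v e+eR≤1 _ with LocalView.w≡2 v _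
... | refl = fits (LocalView.trimmed v) (s≤s (s≤s (s≤s (m+n≤o⇒n≤o e (≤-pred e+eR≤1)))))
weight+paid≤trimmed-weight {false} {false} {true} 2 v _ _ with LocalView.w≡2 v _
weight+paid≤trimmed-weight {false} {false} {true} {e = 1} 2 v e+eR≤2 _ | refl =
  fits (LocalView.trimmed v) (s≤s (s≤s (≤-pred e+eR≤2)))
weight+paid≤trimmed-weight {false} {false} {true} {e = 2} 2 v e+eR≤2 _ | refl =
  fits (LocalView.trimmed v) (s≤s (s≤s (s≤s (≤-pred (≤-pred e+eR≤2)))))

-- The conflict graph around u

module Setting {n : ℕ} (A B : Family n) (u : Subset n)
  (unique-A : Unique A) (disjoint-A : AllPairs Disjoint A)
  (size-A : All (λ s → ∣ s ∣ ≡ 2 ⊎ ∣ s ∣ ≡ 3) A) (size-B : All (λ s → ∣ s ∣ ≡ 2 ⊎ ∣ s ∣ ≡ 3) B)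
  (u∈A : u ∈ A) (u∉C : Classes.isC A B u ≡ false) where
  open Classes A B

  weight : Subset n → ℕ
  weight v = lhs-weight (isB1 v ∨ isB2 v) (w v ≡ᵇ 2) (deg AminusC v) (edges u v)

  lhs≡∑weight : length (N (u ∷ []) B₁∪B₂) + 2 * length (N (u ∷ []) Bc) + length (D₁ u) + 2 * length (D₂ u)
              ≡ ∑ B weight
  lhs≡∑weight = begin
    length (N (u ∷ []) B₁∪B₂) + 2 * length (N (u ∷ []) Bc) + length (D₁ u) + 2 * length (D₂ u)
      ≡⟨ cong₂ _+_ (cong₂ _+_ (cong₂ _+_ near-B₁∪B₂ (cong (2 *_) near-Bc)) in-D₁) (cong (2 *_) in-D₂) ⟩
    ∑ B f₁ + 2 * ∑ B f₂ + ∑ B f₃ + 2 * ∑ B f₄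
      ≡⟨ cong (λ x → x + ∑ B f₃ + 2 * ∑ B f₄) (∑-+-* B f₁ f₂ 2) ⟩
    ∑[ v ∈ B ] (f₁ v + 2 * f₂ v) + ∑ B f₃ + 2 * ∑ B f₄
      ≡⟨ cong (_+ 2 * ∑ B f₄) (∑-+ B (λ v → f₁ v + 2 * f₂ v) f₃) ⟨
    ∑[ v ∈ B ] (f₁ v + 2 * f₂ v + f₃ v) + 2 * ∑ B f₄
      ≡⟨ ∑-+-* B (λ v → f₁ v + 2 * f₂ v + f₃ v) f₄ 2 ⟩
    ∑[ v ∈ B ] (f₁ v + 2 * f₂ v + f₃ v + 2 * f₄ v)
      ≡⟨ ∑-cong B (λ {v} _ → indicators≡lhs-weight (isB1 v ∨ isB2 v) (w v ≡ᵇ 2) (deg AminusC v) (edges u v)) ⟩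
    ∑ B weight ∎
    where
    open ≡-Reasoning
    near-u : Subset n → Bool
    near-u v = meets u v ∨ false
    in-B₁∪B₂ in-rest2 : Subset n → Bool
    in-B₁∪B₂ v = isB1 v ∨ isB2 v
    in-rest2 v = not (isB1 v ∨ isB2 v) ∧ (w v ≡ᵇ 2)
    f₁ f₂ f₃ f₄ : Subset n → ℕ
    f₁ v = if in-B₁∪B₂ v then (if near-u v then 1 else 0) else 0
    f₂ v = if in-rest2 v then (if deg AminusC v ≡ᵇ 1 then (if near-u v then 1 else 0) else 0) else 0
    f₃ v = if in-rest2 v then (if deg AminusC v ≡ᵇ 2 then (if edges u v ≡ᵇ 1 then 1 else 0) else 0) else 0
    f₄ v = if in-rest2 v then (if deg AminusC v ≡ᵇ 2 then (if edges u v ≡ᵇ 2 then 1 else 0) else 0) else 0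
    near-B₁∪B₂ : length (N (u ∷ []) B₁∪B₂) ≡ ∑ B f₁
    near-B₁∪B₂ = trans (length-filterᵇ near-u B₁∪B₂) (∑-filterᵇ in-B₁∪B₂ B _)
    in-rest2-filter : ∀ (p q : Subset n → Bool) → length (filterᵇ p (filterᵇ q rest2))
                    ≡ ∑[ v ∈ B ] (if in-rest2 v then (if q v then (if p v then 1 else 0) else 0) else 0)
    in-rest2-filter p q = trans (length-filterᵇ p (filterᵇ q rest2))
                            (trans (∑-filterᵇ q rest2 _) (∑-filterᵇ in-rest2 B _))
    near-Bc : length (N (u ∷ []) Bc) ≡ ∑ B f₂
    near-Bc = in-rest2-filter near-u (λ v → deg AminusC v ≡ᵇ 1)
    in-D₁ : length (D₁ u) ≡ ∑ B f₃
    in-D₁ = in-rest2-filter (λ v → edges u v ≡ᵇ 1) (λ v → deg AminusC v ≡ᵇ 2)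
    in-D₂ : length (D₂ u) ≡ ∑ B f₄
    in-D₂ = in-rest2-filter (λ v → edges u v ≡ᵇ 2) (λ v → deg AminusC v ≡ᵇ 2)

  _≟ˢ_ : DecidableEquality (Subset n)
  _≟ˢ_ = ≡-dec Bool._≟_

  is-u : Subset n → Bool
  is-u a = does (a ≟ˢ u)

  module Partition (P : Subset n → Bool) (P-u : P u ≡ false) where

    kept : Subset n → Bool
    kept a = is-u a ∨ P a

    Rest : Family n
    Rest = filterᵇ (not ∘ kept) A

    ∑-kept : ∀ f → ∑ (filterᵇ kept A) f ≡ f u + ∑ (filterᵇ P A) f
    ∑-kept f = trans (∑-filterᵇ-∨ is-u P A f u-not-P)
                     (cong (_+ ∑ (filterᵇ P A) f) (∑-filterᵇ-≟ _≟ˢ_ f unique-A u∈A))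
      where
      u-not-P : ∀ {a} → a ∈ A → T (is-u a) → P a ≡ false
      u-not-P {a} _ a≡u with a ≟ˢ u
      ... | yes refl = P-u

    ∑-partition : ∀ f → ∑ A f ≡ f u + ∑ (filterᵇ P A) f + ∑ Rest f
    ∑-partition f = trans (∑-filterᵇ-split kept A f) (cong (_+ ∑ Rest f) (∑-kept f))

    disjoint-Rest : AllPairs Disjoint Rest
    disjoint-Rest = AllPairsₚ.filter⁺ (T? ∘ not ∘ kept) disjoint-A

    deg-partition : ∀ b → deg A b ≡ edges u b + deg (filterᵇ P A) b + deg Rest b
    deg-partition b = ∑-partition (λ a → edges a b)

    nbrs-partition : ∀ b → nbrs A b ≡ adjacent u b + nbrs (filterᵇ P A) b + nbrs Rest b
    nbrs-partition b rewrite nbrs≡∑adjacent A b | nbrs≡∑adjacent (filterᵇ P A) b | nbrs≡∑adjacent Rest b =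
      ∑-partition (λ a → adjacent a b)

  B₂-degrees : ∀ {b} → T (isB2 b) → w b ≡ 2 × deg A b ≡ 2 × nbrs A b ≡ 2
  B₂-degrees {b} b∈B₂ =
    let w≡2 , rest = Equivalence.to T-∧ b∈B₂ ; deg≡2 , nbrs≡2 = Equivalence.to T-∧ rest
    in ≡ᵇ⇒≡ _ _ w≡2 , ≡ᵇ⇒≡ _ _ deg≡2 , ≡ᵇ⇒≡ _ _ nbrs≡2

  module ByC = Partition isC u∉C

  B₁-avoids-C : ∀ b → T (isB1 b) → 1 ≤ edges u b → deg C b ≡ 0
  B₁-avoids-C b b∈B₁ u~b = nbrs≡0⇒deg≡0 C b (m+n≡0⇒m≡0 (nbrs C b) (suc-injective (begin
    1 + nbrs C b + nbrs ByC.Rest b             ≡⟨ cong (λ k → k + nbrs C b + nbrs ByC.Rest b) (adjacent≡1 u b u~b) ⟨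
    adjacent u b + nbrs C b + nbrs ByC.Rest b  ≡⟨ ByC.nbrs-partition b ⟨
    nbrs A b                                   ≡⟨ ≡ᵇ⇒≡ _ _ b∈B₁ ⟩
    1                                          ∎)))
    where open ≡-Reasoning

  B₂-meets-C-once : ∀ b → T (isB2 b) → 1 ≤ edges u b → deg C b ≤ 1
  B₂-meets-C-once b b∈B₂ u~b = ≤-pred (begin
    1 + deg C b                                      ≤⟨ +-monoˡ-≤ (deg C b) u~b ⟩
    edges u b + deg C b                              ≤⟨ m≤m+n _ (deg ByC.Rest b) ⟩
    edges u b + deg C b + deg ByC.Rest b             ≡⟨ ByC.deg-partition b ⟨
    deg A b                                          ≡⟨ proj₁ (proj₂ (B₂-degrees b∈B₂)) ⟩
    2                                                ∎)
    where open ≤-Reasoning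

  size≤3 : ∀ {b} → b ∈ B → ∣ b ∣ ≤ 3
  size≤3 b∈B with lookup size-B b∈B
  ... | inj₁ ∣b∣≡2 = ≤-trans (≤-reflexive ∣b∣≡2) (n≤1+n 2)
  ... | inj₂ ∣b∣≡3 = ≤-reflexive ∣b∣≡3

  w≡2⇒∣∣≡3 : ∀ {b} → b ∈ B → w b ≡ 2 → ∣ b ∣ ≡ 3
  w≡2⇒∣∣≡3 {b} b∈B w≡2 with lookup size-B b∈B
  ... | inj₁ ∣b∣≡2 = contradiction (trans (sym w≡2) (cong (_∸ 1) ∣b∣≡2)) λ ()
  ... | inj₂ ∣b∣≡3 = ∣b∣≡3

  deg-C≤weight : ∀ {b} → b ∈ B → 1 ≤ weight b → deg C b ≤ weight b
  deg-C≤weight {b} b∈B = cost≤lhs-weight (isB1 b) (isB2 b) (w b ≡ᵇ 2) (deg AminusC b) (edges u b)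
    (≤-trans (deg≤∣∣ b disjoint-A) (size≤3 b∈B)) (sym (∑-filterᵇ-split isC A (λ a → edges a b)))
    (B₁-avoids-C b) (B₂-meets-C-once b)

  pay : Subset n → Subset n → ℕ
  pay a v = (if isB1 v then (if meets a v then w v else 0) else 0) + (if isB2 v then edges a v else 0)

  received≡∑pay : ∀ a → received a ≡ ∑[ v ∈ B ] pay a v
  received≡∑pay a = begin
    wF (filterᵇ (meets a) B₁) + ∑ B₂ (edges a)
      ≡⟨ cong₂ _+_ (trans (∑-filterᵇ (meets a) B₁ w) (∑-filterᵇ isB1 B _)) (∑-filterᵇ isB2 B (edges a)) ⟩
    ∑[ v ∈ B ] (if isB1 v then (if meets a v then w v else 0) else 0) + ∑[ v ∈ B ] (if isB2 v then edges a v else 0)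
      ≡⟨ ∑-+ B (λ v → if isB1 v then (if meets a v then w v else 0) else 0) (λ v → if isB2 v then edges a v else 0) ⟨
    ∑ B (pay a) ∎
    where open ≡-Reasoning

  module Marked (M : List (Subset n × Bool)) (M-covers-B : map proj₁ M ≡ B) where

    S : Family n
    S = marked M

    S⊆B : ∀ {v} → v ∈ S → v ∈ B
    S⊆B v∈S = subst (_ ∈_) M-covers-B (map⁺ proj₁ (filter-⊆ (T? ∘ proj₂) M) v∈S)

    met : Subset n → Bool
    met a = isC a ∧ any (meets a) S

    Cₘ : Family n
    Cₘ = filterᵇ met A

    open Partition met (cong (_∧ any (meets u) S) u∉C) public

    trim : Subset n → Subset n
    trim v = v ∩ ∁ (⋃ Rest)

    ∣trim∣+deg-Rest : ∀ v → ∣ trim v ∣ + deg Rest v ≡ ∣ v ∣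
    ∣trim∣+deg-Rest v = begin
      ∣ v ∩ ∁ (⋃ Rest) ∣ + deg Rest v           ≡⟨ cong (∣ v ∩ ∁ (⋃ Rest) ∣ +_) (∣b∩⋃∣≡deg v disjoint-Rest) ⟨
      ∣ v ∩ ∁ (⋃ Rest) ∣ + ∣ v ∩ ⋃ Rest ∣       ≡⟨ +-comm ∣ v ∩ ∁ (⋃ Rest) ∣ ∣ v ∩ ⋃ Rest ∣ ⟩
      ∣ v ∩ ⋃ Rest ∣ + ∣ v ∩ ∁ (⋃ Rest) ∣       ≡⟨ ∣p∩q∣+∣p∩∁q∣≡∣p∣ v (⋃ Rest) ⟩
      ∣ v ∣                                     ∎
      where open ≡-Reasoning

    paid-to-Cₘ : Subset n → ℕ
    paid-to-Cₘ v = ∑[ a ∈ Cₘ ] pay a v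

    paid-to-Cₘ≡ : ∀ v → paid-to-Cₘ v ≡ paid (isB1 v) (isB2 v) ∣ v ∣ (deg Cₘ v) (nbrs Cₘ v)
    paid-to-Cₘ≡ v = begin
      ∑[ a ∈ Cₘ ] pay a v
        ≡⟨ ∑-+ Cₘ (λ a → if isB1 v then (if meets a v then w v else 0) else 0) (λ a → if isB2 v then edges a v else 0) ⟩
      ∑[ a ∈ Cₘ ] (if isB1 v then (if meets a v then w v else 0) else 0) + ∑[ a ∈ Cₘ ] (if isB2 v then edges a v else 0)
        ≡⟨ cong₂ _+_ (∑-if Cₘ (isB1 v) (λ a → if meets a v then w v else 0)) (∑-if Cₘ (isB2 v) (λ a → edges a v)) ⟩
      (if isB1 v then ∑[ a ∈ Cₘ ] (if meets a v then w v else 0) else 0) + (if isB2 v then deg Cₘ v else 0)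
        ≡⟨ cong (λ k → (if isB1 v then k else 0) + (if isB2 v then deg Cₘ v else 0)) weight-per-nbr ⟩
      paid (isB1 v) (isB2 v) ∣ v ∣ (deg Cₘ v) (nbrs Cₘ v) ∎
      where
      open ≡-Reasoning
      if-as-* : ∀ c m → (if c then m else 0) ≡ m * (if c then 1 else 0)
      if-as-* true  m = sym (*-identityʳ m)
      if-as-* false m = sym (*-zeroʳ m)
      weight-per-nbr : ∑[ a ∈ Cₘ ] (if meets a v then w v else 0) ≡ w v * nbrs Cₘ v
      weight-per-nbr = begin
        ∑[ a ∈ Cₘ ] (if meets a v then w v else 0) ≡⟨ ∑-cong Cₘ (λ {a} _ → if-as-* (meets a v) (w v)) ⟩
        ∑[ a ∈ Cₘ ] (w v * adjacent a v)         ≡⟨ ∑-*ˡ Cₘ (w v) (λ a → adjacent a v) ⟩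
        w v * ∑[ a ∈ Cₘ ] adjacent a v           ≡⟨ cong (w v *_) (nbrs≡∑adjacent Cₘ v) ⟨
        w v * nbrs Cₘ v                          ∎

    ∈Cₘ⁻ : ∀ {a} → a ∈ Cₘ → a ∈ A × T (isC a) × T (any (meets a) S)
    ∈Cₘ⁻ a∈Cₘ = let a∈A , met-a = ∈-filter⁻ (T? ∘ met) {xs = A} a∈Cₘ in a∈A , Equivalence.to T-∧ met-a

    ∑paid≡wF : ∑ B paid-to-Cₘ ≡ wF Cₘ
    ∑paid≡wF = begin
      ∑[ v ∈ B ] ∑[ a ∈ Cₘ ] pay a v  ≡⟨ ∑-comm Cₘ B (λ a v → pay a v) ⟨
      ∑[ a ∈ Cₘ ] ∑[ v ∈ B ] pay a v  ≡⟨ ∑-cong Cₘ (λ {a} _ → received≡∑pay a) ⟨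
      ∑ Cₘ received                   ≡⟨ ∑-cong Cₘ (λ a∈Cₘ → ≡ᵇ⇒≡ _ _ (proj₁ (proj₂ (∈Cₘ⁻ a∈Cₘ)))) ⟩
      wF Cₘ                           ∎
      where open ≡-Reasoning

    view : ∀ {v} → v ∈ B → LocalView (isB1 v) (isB2 v) (w v ≡ᵇ 2) ∣ v ∣ ∣ trim v ∣
                                      (edges u v) (deg Cₘ v) (deg Rest v) (nbrs Cₘ v) (nbrs Rest v)
    view {v} v∈B = record
      { size      = lookup size-B v∈B
      ; trimmed   = ∣trim∣+deg-Rest v
      ; B₁-nbrs   = λ v∈B₁ → trans (sym (nbrs-partition v)) (≡ᵇ⇒≡ _ _ v∈B₁)
      ; rest-nbrs = nbrs≡0⇒deg≡0 Rest v
      ; B₂-degs   = λ v∈B₂ → let w≡2 , deg≡2 , nbrs≡2 = B₂-degrees v∈B₂ in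
                      cong (_≡ᵇ 1) nbrs≡2 , w≡2⇒∣∣≡3 v∈B w≡2 , trans (sym (deg-partition v)) deg≡2
      ; w≡2       = λ w≡2 → w≡2⇒∣∣≡3 v∈B (≡ᵇ⇒≡ (w v) 2 w≡2)
      }

    marked-avoids-Rest : ∀ {v} → v ∈ S → edges u v + deg Rest v ≤ deg AminusC v
    marked-avoids-Rest {v} v∈S = +-cancelʳ-≤ (deg C v) _ _ (begin
      edges u v + deg Rest v + deg C v    ≤⟨ +-monoʳ-≤ (edges u v + deg Rest v) C⊆Cₘ ⟩
      edges u v + deg Rest v + deg Cₘ v   ≡⟨ xy∙z≈xz∙y (edges u v) (deg Rest v) (deg Cₘ v) ⟩
      edges u v + deg Cₘ v + deg Rest v   ≡⟨ deg-partition v ⟨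
      deg A v                             ≡⟨ ∑-filterᵇ-split isC A (λ a → edges a v) ⟩
      deg C v + deg AminusC v             ≡⟨ +-comm (deg C v) (deg AminusC v) ⟩
      deg AminusC v + deg C v             ∎)
      where
      open ≤-Reasoning
      C⊆Cₘ : deg C v ≤ deg Cₘ v
      C⊆Cₘ = ∑-filterᵇ-mono-≤ isC met A (λ a → edges a v) λ {a} _ a∈C a~v →
        Equivalence.from T-∧ (a∈C , any⁺ (meets a) (lose v∈S (≤⇒≤ᵇ a~v)))

    M⊆B : ∀ {p} → p ∈ M → proj₁ p ∈ B
    M⊆B p∈M = subst (_ ∈_) M-covers-B (∈-map⁺ proj₁ p∈M)

    ∑-M : ∀ f → ∑[ p ∈ M ] f (proj₁ p) ≡ ∑ B f
    ∑-M f = trans (sym (∑-map proj₁ M f)) (cong (λ xs → ∑ xs f) M-covers-B)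

    ∑-S : ∀ f → ∑ S f ≡ ∑[ p ∈ M ] (if proj₂ p then f (proj₁ p) else 0)
    ∑-S f = trans (∑-map proj₁ (filterᵇ proj₂ M) f) (∑-filterᵇ proj₂ M (f ∘ proj₁))

    ∈S⁺ : ∀ {v} → (v , true) ∈ M → v ∈ S
    ∈S⁺ v∈M = ∈-map⁺ proj₁ (∈-filter⁺ (T? ∘ proj₂) v∈M _)

    chosen : Subset n × Bool → Bool
    chosen (v , χ) = χ ∨ (1 ≤ᵇ paid-to-Cₘ v)

    X : Family n
    X = map (trim ∘ proj₁) (filterᵇ chosen M)

    wF-X : wF X ≡ ∑[ p ∈ M ] (if chosen p then w (trim (proj₁ p)) else 0)
    wF-X = trans (∑-map (trim ∘ proj₁) (filterᵇ chosen M) w) (∑-filterᵇ chosen M (w ∘ trim ∘ proj₁))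

    length-X≤ : length X ≤ length S + wF Cₘ
    length-X≤ = begin
      length X                                                   ≡⟨ length-map (trim ∘ proj₁) (filterᵇ chosen M) ⟩
      length (filterᵇ chosen M)                                  ≡⟨ length-filterᵇ chosen M ⟩
      ∑[ p ∈ M ] (if chosen p then 1 else 0)                     ≤⟨ ∑-mono-≤ M (λ {p} _ → count-chosen (proj₂ p) (paid-to-Cₘ (proj₁ p))) ⟩
      ∑[ p ∈ M ] ((if proj₂ p then 1 else 0) + paid-to-Cₘ (proj₁ p))
        ≡⟨ ∑-+ M (λ p → if proj₂ p then 1 else 0) (paid-to-Cₘ ∘ proj₁) ⟩
      ∑[ p ∈ M ] (if proj₂ p then 1 else 0) + ∑[ p ∈ M ] paid-to-Cₘ (proj₁ p)
        ≡⟨ cong₂ _+_ (trans (sym (∑-S (λ _ → 1))) (sym (length≡∑1 S))) (trans (∑-M paid-to-Cₘ) ∑paid≡wF) ⟩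
      length S + wF Cₘ                                           ∎
      where
      open ≤-Reasoning
      count-chosen : ∀ χ r → (if χ ∨ (1 ≤ᵇ r) then 1 else 0) ≤ (if χ then 1 else 0) + r
      count-chosen true  r       = s≤s z≤n
      count-chosen false zero    = z≤n
      count-chosen false (suc r) = s≤s z≤n

    wF-Cₘ≤ : wF Cₘ ≤ 2 * length Cₘ
    wF-Cₘ≤ = begin
      ∑ Cₘ w                 ≤⟨ ∑-mono-≤ Cₘ (λ {a} a∈Cₘ → w≤2 {a} (lookup size-A (proj₁ (∈Cₘ⁻ a∈Cₘ)))) ⟩
      ∑[ a ∈ Cₘ ] (2 * 1)    ≡⟨ ∑-*ˡ Cₘ 2 (λ _ → 1) ⟩
      2 * ∑[ a ∈ Cₘ ] 1      ≡⟨ cong (2 *_) (length≡∑1 Cₘ) ⟨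
      2 * length Cₘ          ∎
      where
      open ≤-Reasoning
      w≤2 : ∀ {a} → ∣ a ∣ ≡ 2 ⊎ ∣ a ∣ ≡ 3 → w a ≤ 2
      w≤2 (inj₁ ∣a∣≡2) = ≤-trans (≤-reflexive (cong (_∸ 1) ∣a∣≡2)) (s≤s z≤n)
      w≤2 (inj₂ ∣a∣≡3) = ≤-reflexive (cong (_∸ 1) ∣a∣≡3)

    length-Cₘ≤ : length Cₘ ≤ ∑ S (deg C)
    length-Cₘ≤ = begin
      length Cₘ                          ≡⟨ length≡∑1 Cₘ ⟩
      ∑[ a ∈ Cₘ ] 1                      ≤⟨ ∑-mono-≤ Cₘ meets-S ⟩
      ∑[ a ∈ Cₘ ] ∑[ v ∈ S ] edges a v   ≡⟨ ∑-comm Cₘ S edges ⟩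
      ∑ S (deg Cₘ)                       ≤⟨ ∑-mono-≤ S (λ {v} _ → ∑-filterᵇ-mono-≤ met isC A (λ a → edges a v)
                                              (λ _ a∈Cₘ _ → proj₁ (Equivalence.to T-∧ a∈Cₘ))) ⟩
      ∑ S (deg C)                        ∎
      where
      open ≤-Reasoning
      meets-S : ∀ {a} → a ∈ Cₘ → 1 ≤ ∑[ v ∈ S ] edges a v
      meets-S {a} a∈Cₘ =
        let v , v∈S , a~v = find (any⁻ (meets a) S (proj₂ (proj₂ (∈Cₘ⁻ a∈Cₘ))))
        in ≤-trans (≤ᵇ⇒≤ 1 _ a~v) (∑-member (edges a) v∈S)

    trim-avoids-Rest : ∀ v {a} → a ∈ Rest → ¬ T (meets (trim v) a)
    trim-avoids-Rest v {a} a∈Rest = subst (λ e → T (1 ≤ᵇ e)) trim∩a≡0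
      where
      trim∩a≡0 : edges (trim v) a ≡ 0
      trim∩a≡0 = Empty⇒∣p∣≡0 (disjoint λ x∈trim x∈a →
        x∈∁p⇒x∉p (p∩q⊆q v (∁ (⋃ Rest)) x∈trim) (⊆⋃ a∈Rest x∈a))

    wF-N-X≤ : wF (N X A) ≤ w u + wF Cₘ
    wF-N-X≤ = ≤-trans (∑-filterᵇ-mono-≤ (λ a → any (λ x → meets x a) X) kept A w touched⇒kept)
                      (≤-reflexive (∑-kept w))
      where
      touched⇒kept : ∀ {a} → a ∈ A → T (any (λ x → meets x a) X) → 1 ≤ w a → T (kept a)
      touched⇒kept {a} a∈A touched _ with kept a in kept-a
      ... | true  = _
      ... | false =
        let x , x∈X , x~a = find (any⁻ (λ x → meets x a) X touched)
            p , _ , x≡trim = ∈-map⁻ (trim ∘ proj₁) x∈X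
            a∈Rest = ∈-filter⁺ (T? ∘ not ∘ kept) a∈A (subst (T ∘ not) (sym kept-a) _)
        in trim-avoids-Rest (proj₁ p) a∈Rest (subst (λ y → T (meets y a)) x≡trim x~a)

    X-disjoint : AllPairs Disjoint B → AllPairs Disjoint X
    X-disjoint disjoint-B = AllPairsₚ.map⁺ (AllPairsₚ.filter⁺ (T? ∘ chosen) (AllPairs.map (∩-Disjoint (∁ (⋃ Rest)))
      (AllPairsₚ.map⁻ (subst (AllPairs Disjoint) (sym M-covers-B) disjoint-B))))

    module _ (S-positive : All (λ v → 1 ≤ weight v) S) where

      chosen-gain : ∀ {p} → p ∈ M → (if proj₂ p then weight (proj₁ p) else 0) + paid-to-Cₘ (proj₁ p)
                                    ≤ (if chosen p then w (trim (proj₁ p)) else 0)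
      chosen-gain {v , true} p∈M = subst (λ k → weight v + k ≤ w (trim v)) (sym (paid-to-Cₘ≡ v))
        (weight+paid≤trimmed-weight (deg AminusC v) (view (M⊆B p∈M)) (marked-avoids-Rest (∈S⁺ p∈M))
                                    (lookup S-positive (∈S⁺ p∈M)))
      chosen-gain {v , false} p∈M with paid-to-Cₘ v in paid≡
      ... | zero  = z≤n
      ... | suc _ = subst (_≤ w (trim v)) (trans (sym (paid-to-Cₘ≡ v)) paid≡)
                          (paid≤trimmed-weight (view (M⊆B p∈M)))

      chosen-heavy : ∀ {p} → p ∈ M → T (chosen p) → 1 ≤ w (trim (proj₁ p))
      chosen-heavy {v , true}  p∈M _ =
        ≤-trans (lookup S-positive (∈S⁺ p∈M)) (≤-trans (m≤m+n _ _) (chosen-gain p∈M))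
      chosen-heavy {v , false} p∈M paid>0 = ≤-trans (≤ᵇ⇒≤ 1 _ paid>0)
        (subst (λ c → paid-to-Cₘ v ≤ (if c then w (trim v) else 0)) (Equivalence.to T-≡ paid>0) (chosen-gain p∈M))

      X⊆𝒮 : ∀ {𝒮} → Instance 𝒮 → All (_∈ 𝒮) B → All (_∈ 𝒮) X
      X⊆𝒮 inst B⊆𝒮 = Allₚ.map⁺ (tabulate λ {p} p∈ →
        let p∈M , p-chosen = ∈-filter⁻ (T? ∘ chosen) {xs = M} p∈
        in Instance.hereditary inst (lookup B⊆𝒮 (M⊆B p∈M)) (p∩q⊆p (proj₁ p) _)
             (∣p∣>0⇒Nonempty _ (≤-trans (chosen-heavy p∈M p-chosen) (m∸n≤m _ 1))))

      wF-X≥ : 3 ≤ ∑ S weight → 3 + wF Cₘ ≤ wF X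
      wF-X≥ enough = begin
        3 + wF Cₘ                                               ≤⟨ +-monoˡ-≤ (wF Cₘ) enough ⟩
        ∑ S weight + wF Cₘ                                      ≡⟨ cong₂ _+_ (∑-S weight) (sym (trans (∑-M paid-to-Cₘ) ∑paid≡wF)) ⟩
        ∑[ p ∈ M ] (if proj₂ p then weight (proj₁ p) else 0) + ∑[ p ∈ M ] paid-to-Cₘ (proj₁ p)
          ≡⟨ ∑-+ M (λ p → if proj₂ p then weight (proj₁ p) else 0) (paid-to-Cₘ ∘ proj₁) ⟨
        ∑[ p ∈ M ] ((if proj₂ p then weight (proj₁ p) else 0) + paid-to-Cₘ (proj₁ p))
          ≤⟨ ∑-mono-≤ M chosen-gain ⟩
        ∑[ p ∈ M ] (if chosen p then w (trim (proj₁ p)) else 0) ≡⟨ wF-X ⟨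
        wF X                                                    ∎
        where open ≤-Reasoning

      local-improvement : w u ≡ 2 → 3 ≤ ∑ S weight → length S + 2 * ∑ S weight ≤ 10 →
                          length X ≤ 10 × wF (N X A) < wF X
      local-improvement w-u≡2 enough cheap = length-X≤10 , heavier
        where
        open ≤-Reasoning
        length-X≤10 : length X ≤ 10
        length-X≤10 = begin
          length X                      ≤⟨ length-X≤ ⟩
          length S + wF Cₘ              ≤⟨ +-monoʳ-≤ (length S) (≤-trans wF-Cₘ≤ (*-monoʳ-≤ 2 length-Cₘ≤)) ⟩
          length S + 2 * ∑ S (deg C)    ≤⟨ +-monoʳ-≤ (length S) (*-monoʳ-≤ 2 (∑-mono-≤ S λ v∈S →
                                             deg-C≤weight (S⊆B v∈S) (lookup S-positive v∈S))) ⟩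
          length S + 2 * ∑ S weight     ≤⟨ cheap ⟩
          10                            ∎
        heavier : wF (N X A) < wF X
        heavier = begin-strict
          wF (N X A)    ≤⟨ wF-N-X≤ ⟩
          w u + wF Cₘ   ≡⟨ cong (_+ wF Cₘ) w-u≡2 ⟩
          2 + wF Cₘ     <⟨ ≤-refl ⟩
          3 + wF Cₘ     ≤⟨ wF-X≥ enough ⟩
          wF X          ∎

  ∑weight≤2 : ∀ {𝒮} → Instance 𝒮 → NoLocalImprovement≤ 10 𝒮 A → All (_∈ 𝒮) B → AllPairs Disjoint B →
              w u ≡ 2 → ∑ B weight ≤ 2
  ∑weight≤2 inst no-improvement B⊆𝒮 disjoint-B w-u≡2 with ∑ B weight ≤? 2
  ... | yes ∑≤2 = ∑≤2
  ... | no  ∑≰2 with select weight (λ v → lhs-weight≤2 _ _ _ _) B (≰⇒> ∑≰2)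
  ...   | mkMarking M M-covers-B (positive , enough , cheap) =
    let open Marked M M-covers-B
        length≤10 , heavier = local-improvement positive w-u≡2 enough cheap
    in ⊥-elim (no-improvement X (X⊆𝒮 positive inst B⊆𝒮 , X-disjoint disjoint-B) length≤10 (inj₁ heavier))


lemma6 : (n : ℕ) (𝒮 A B : Family n)
    → Instance 𝒮
    → Feasible 𝒮 A
    → NoLocalImprovement≤ 10 𝒮 A
    → Optimum 𝒮 B
    → All (λ s → ∣ s ∣ ≡ 2 ⊎ ∣ s ∣ ≡ 3) A
    → All (λ s → ∣ s ∣ ≡ 2 ⊎ ∣ s ∣ ≡ 3) B
    → (u : Subset n) → u ∈ A → Classes.isC A B u ≡ false → w u ≡ 2
    → length (N (u ∷ []) (Classes.B₁∪B₂ A B))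
        + 2 * length (N (u ∷ []) (Classes.Bc A B))
        + length (Classes.D₁ A B u)
        + 2 * length (Classes.D₂ A B u) ≤ 2
lemma6 n 𝒮 A B inst ((_ , disjoint-A) , unique-A) no-improvement (((B⊆𝒮 , disjoint-B) , _) , _)
       size-A size-B u u∈A u∉C w-u≡2 =
  subst (_≤ 2) (sym lhs≡∑weight) (∑weight≤2 inst no-improvement B⊆𝒮 disjoint-B w-u≡2)
  where open Setting A B u unique-A disjoint-A size-A size-B u∈A u∉C
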